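{- Let $n\ge 2r+1$. For any subgraph $G$ of the Kneser graph $K_{n:r}$ whose maximum degree is strictly less than $\frac{n-r}{n-2r}$, the graph $H_{n:r}$ has a subgraph isomorphic to $G$.
   Context: For positive integers $n,r$ write $[n]=\{1,\dots,n\}$. The Kneser graph $K_{n:r}$ has the $r$-element subsets of $[n]$ as vertices, two being adjacent iff disjoint. The Häggkvist–Hell graph $H_{n:r}$ is the graph whose vertices are the ordered pairs $(h,T)$ where $T$ is an $r$-element subset of $[n]$ and $h\in[n]\setminus T$; two vertices $(h_x,T_x)$ and $(h_y,T_y)$ are adjacent iff $h_x\in T_y$, $h_y\in T_x$ and $T_x\cap T_y=\varnothing$. -}

module Defs where

open import Data.Nat using (ℕ; zero; suc; _+_; _*_; _∸_; _<_; _≤_)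
open import Data.Bool using (Bool; true; false; if_then_else_)
open import Data.Fin using (Fin)
open import Data.Fin.Subset using (Subset; ∣_∣; _∈_; _∉_; _∩_; Empty; inside; outside)
open import Data.Vec using ([]; _∷_)
open import Data.List using (List; map; _++_) renaming ([] to []ₗ; _∷_ to _∷ₗ_)
open import Data.Product using (_×_; _,_; Σ)
open import Data.Nat.ListAction using (sum)
open import Relation.Binary.PropositionalEquality using (_≡_)

allSubsets : (n : ℕ) → List (Subset n)
allSubsets zero = [] ∷ₗ []ₗ
allSubsets (suc n) = map (outside ∷_) (allSubsets n) ++ map (inside ∷_) (allSubsets n)

Disjoint : ∀ {n} → Subset n → Subset n → Set
Disjoint S T = Empty (S ∩ T)

-- Vertices of the Kneser graph K_{n:r}: r-element subsets of [n]; adjacency = disjointness.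
KVertex : (n r : ℕ) → Subset n → Set
KVertex n r S = ∣ S ∣ ≡ r

record KneserSubgraph (n r : ℕ) : Set where
  field
    inV      : Subset n → Bool
    adj      : Subset n → Subset n → Bool
    V-vertex : ∀ S → inV S ≡ true → KVertex n r S
    adj-V    : ∀ S T → adj S T ≡ true → (inV S ≡ true) × (inV T ≡ true)
    adj-K    : ∀ S T → adj S T ≡ true → Disjoint S T
    adj-sym  : ∀ S T → adj S T ≡ adj T S

degree : ∀ {n r} → KneserSubgraph n r → Subset n → ℕ
degree {n} G S = sum (map (λ T → if KneserSubgraph.adj G S T then 1 else 0) (allSubsets n))

HVertex : (n r : ℕ) → Fin n × Subset n → Set
HVertex n r (h , T) = (∣ T ∣ ≡ r) × (h ∉ T)

HAdj : ∀ {n} → Fin n × Subset n → Fin n × Subset n → Set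
HAdj (hx , Tx) (hy , Ty) = (hx ∈ Ty) × (hy ∈ Tx) × Disjoint Tx Ty

-- H_{n:r} has a subgraph isomorphic to G: there is a map from the vertices of G to
-- vertices of H_{n:r}, injective on V(G), sending edges of G to edges of H_{n:r}
-- (its image, with the image edges, is the required subgraph).
HasSubgraphIsoTo : (n r : ℕ) → KneserSubgraph n r → Set
HasSubgraphIsoTo n r G =
  Σ (Subset n → Fin n × Subset n) λ φ →
    (∀ S → inV S ≡ true → HVertex n r (φ S)) ×
    (∀ S S′ → inV S ≡ true → inV S′ ≡ true → φ S ≡ φ S′ → S ≡ S′) ×
    (∀ S S′ → adj S S′ ≡ true → HAdj (φ S) (φ S′))
  where open KneserSubgraph G

module Submission where

-- Send a vertex S of G to the vertex (h_S , S) of H_{n:r},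
-- where the "head" h_S lies outside S but inside every neighbour of S in G.
-- Such a map is injective (it remembers S) and carries edges of G to edges of
-- H_{n:r} (h_S ∈ S′, h_{S′} ∈ S, and S, S′ are disjoint), so it exhibits G
-- inside H_{n:r}.  A head exists by counting: a point of ∁ S fails to be a head
-- only if it lies in ∁ S ∩ ∁ T for some neighbour T, and for disjoint r-sets
-- S, T this set has exactly n - 2r points.  Hence at most deg(S) · (n - 2r)
-- points of ∁ S are not heads, which is fewer than ∣ ∁ S ∣ = n - r.

open import Defs
import Algebra.Lattice.Properties.BooleanAlgebra as BooleanAlgebraProperties
open import Data.Bool using (Bool; true; false; if_then_else_; _≟_)
open import Data.Fin using (Fin; fromℕ<)
open import Data.Fin.Subset
  using (Subset; ∣_∣; _∈_; _∉_; _⊆_; _∩_; _∪_; ∁; ⋃; Nonempty; Empty; inside; outside)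
open import Data.Fin.Subset.Properties
  using ( p⊆q⇒∣p∣≤∣q∣; ∣∁p∣≡n∸∣p∣; Empty-unique; ∣⊥∣≡0; nonempty?; _∈?_
        ; x∈p∩q⁺; x∈p∩q⁻; x∈p∪q⁺; x∈∁p⇒x∉p; x∉p⇒x∈∁p; x∉∁p⇒x∈p
        ; ∪-∩-booleanAlgebra)
open import Data.Vec using ([]; _∷_)
open import Data.List using (List; map; length; filter) renaming ([] to []ₗ; _∷_ to _∷ₗ_)
open import Data.List.Membership.Propositional using () renaming (_∈_ to _∈ₗ_)
open import Data.List.Membership.Propositional.Properties
  using (∈-map⁺; ∈-++⁺ˡ; ∈-++⁺ʳ; ∈-filter⁺; ∈-filter⁻)
open import Data.List.Relation.Unary.Any using (here; there)
open import Data.Nat using (ℕ; zero; suc; _+_; _*_; _∸_; _<_; _≤_)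
open import Data.Nat.ListAction using (sum)
open import Data.Nat.Properties
  using (module ≤-Reasoning; +-suc; +-identityʳ; ≤-trans; ≤-reflexive; +-monoʳ-≤; m≤m+n; m≤n+m; <-irrefl; ≤-<-trans)
open import Data.Product using (_×_; _,_; proj₁; proj₂)
open import Data.Sum using (inj₁; inj₂)
open import Data.Empty using (⊥-elim)
open import Relation.Nullary using (¬_; Dec; yes; no)
open import Relation.Binary.PropositionalEquality

∣p∪q∣+∣p∩q∣≡∣p∣+∣q∣ : ∀ {n} (p q : Subset n) → ∣ p ∪ q ∣ + ∣ p ∩ q ∣ ≡ ∣ p ∣ + ∣ q ∣
∣p∪q∣+∣p∩q∣≡∣p∣+∣q∣ []            []            = refl
∣p∪q∣+∣p∩q∣≡∣p∣+∣q∣ (outside ∷ p) (outside ∷ q) = ∣p∪q∣+∣p∩q∣≡∣p∣+∣q∣ p q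
∣p∪q∣+∣p∩q∣≡∣p∣+∣q∣ (inside  ∷ p) (outside ∷ q) = cong suc (∣p∪q∣+∣p∩q∣≡∣p∣+∣q∣ p q)
∣p∪q∣+∣p∩q∣≡∣p∣+∣q∣ (outside ∷ p) (inside  ∷ q) =
  trans (cong suc (∣p∪q∣+∣p∩q∣≡∣p∣+∣q∣ p q)) (sym (+-suc ∣ p ∣ ∣ q ∣))
∣p∪q∣+∣p∩q∣≡∣p∣+∣q∣ (inside  ∷ p) (inside  ∷ q) = begin
  suc (∣ p ∪ q ∣ + suc ∣ p ∩ q ∣) ≡⟨ cong suc (+-suc ∣ p ∪ q ∣ ∣ p ∩ q ∣) ⟩
  suc (suc (∣ p ∪ q ∣ + ∣ p ∩ q ∣)) ≡⟨ cong (λ k → suc (suc k)) (∣p∪q∣+∣p∩q∣≡∣p∣+∣q∣ p q) ⟩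
  suc (suc (∣ p ∣ + ∣ q ∣))       ≡⟨ cong suc (+-suc ∣ p ∣ ∣ q ∣) ⟨
  suc (∣ p ∣ + suc ∣ q ∣)         ∎
  where open ≡-Reasoning

∣p∪q∣≤∣p∣+∣q∣ : ∀ {n} (p q : Subset n) → ∣ p ∪ q ∣ ≤ ∣ p ∣ + ∣ q ∣
∣p∪q∣≤∣p∣+∣q∣ p q =
  ≤-trans (m≤m+n ∣ p ∪ q ∣ ∣ p ∩ q ∣) (≤-reflexive (∣p∪q∣+∣p∩q∣≡∣p∣+∣q∣ p q))

∣p∪q∣≡∣p∣+∣q∣ : ∀ {n} (p q : Subset n) → Disjoint p q → ∣ p ∪ q ∣ ≡ ∣ p ∣ + ∣ q ∣
∣p∪q∣≡∣p∣+∣q∣ {n} p q disj = begin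
  ∣ p ∪ q ∣               ≡⟨ +-identityʳ ∣ p ∪ q ∣ ⟨
  ∣ p ∪ q ∣ + 0           ≡⟨ cong (λ k → ∣ p ∪ q ∣ + k) ∣p∩q∣≡0 ⟨
  ∣ p ∪ q ∣ + ∣ p ∩ q ∣   ≡⟨ ∣p∪q∣+∣p∩q∣≡∣p∣+∣q∣ p q ⟩
  ∣ p ∣ + ∣ q ∣           ∎
  where
  open ≡-Reasoning
  ∣p∩q∣≡0 : ∣ p ∩ q ∣ ≡ 0
  ∣p∩q∣≡0 = trans (cong ∣_∣ (Empty-unique disj)) (∣⊥∣≡0 n)

∣∁p∩∁q∣ : ∀ {n} (p q : Subset n) → Disjoint p q → ∣ ∁ p ∩ ∁ q ∣ ≡ n ∸ (∣ p ∣ + ∣ q ∣)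
∣∁p∩∁q∣ {n} p q disj = begin
  ∣ ∁ p ∩ ∁ q ∣    ≡⟨ cong ∣_∣ (BooleanAlgebraProperties.deMorgan₂ (∪-∩-booleanAlgebra n) p q) ⟨
  ∣ ∁ (p ∪ q) ∣    ≡⟨ ∣∁p∣≡n∸∣p∣ (p ∪ q) ⟩
  n ∸ ∣ p ∪ q ∣    ≡⟨ cong (n ∸_) (∣p∪q∣≡∣p∣+∣q∣ p q disj) ⟩
  n ∸ (∣ p ∣ + ∣ q ∣) ∎
  where open ≡-Reasoning

∈⋃⁺ : ∀ {n} {x : Fin n} {p : Subset n} {ps : List (Subset n)} → p ∈ₗ ps → x ∈ p → x ∈ ⋃ ps
∈⋃⁺ (here refl) x∈p = x∈p∪q⁺ (inj₁ x∈p)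
∈⋃⁺ (there p∈ps) x∈p = x∈p∪q⁺ (inj₂ (∈⋃⁺ p∈ps x∈p))

∣⋃∣≤sum : ∀ {n} {A : Set} (f : A → Subset n) (xs : List A) →
  ∣ ⋃ (map f xs) ∣ ≤ sum (map (λ x → ∣ f x ∣) xs)
∣⋃∣≤sum {n} f []ₗ = ≤-reflexive (∣⊥∣≡0 n)
∣⋃∣≤sum f (x ∷ₗ xs) =
  ≤-trans (∣p∪q∣≤∣p∣+∣q∣ (f x) (⋃ (map f xs))) (+-monoʳ-≤ ∣ f x ∣ (∣⋃∣≤sum f xs))

∈-allSubsets : ∀ n (S : Subset n) → S ∈ₗ allSubsets n
∈-allSubsets zero    []            = here refl
∈-allSubsets (suc n) (outside ∷ S) = ∈-++⁺ˡ (∈-map⁺ (outside ∷_) (∈-allSubsets n S))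
∈-allSubsets (suc n) (inside  ∷ S) = ∈-++⁺ʳ _ (∈-map⁺ (inside ∷_) (∈-allSubsets n S))

sum-indicator≡length-filter : ∀ {A : Set} (f : A → Bool) (xs : List A) →
  sum (map (λ x → if f x then 1 else 0) xs) ≡ length (filter (λ x → f x ≟ true) xs)
sum-indicator≡length-filter f []ₗ = refl
sum-indicator≡length-filter f (x ∷ₗ xs) with f x
... | true  = cong suc (sum-indicator≡length-filter f xs)
... | false = sum-indicator≡length-filter f xs

sum-constant : ∀ {A : Set} (g : A → ℕ) (c : ℕ) (xs : List A) →
  (∀ x → x ∈ₗ xs → g x ≡ c) → sum (map g xs) ≡ length xs * c
sum-constant g c []ₗ       _      = refl
sum-constant g c (x ∷ₗ xs) g≡c =
  cong₂ _+_ (g≡c x (here refl)) (sum-constant g c xs (λ y y∈xs → g≡c y (there y∈xs)))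

pointOf : ∀ {n} {p : Subset n} → Fin n → Dec (Nonempty p) → Fin n
pointOf _  (yes (x , _)) = x
pointOf x₀ (no _)        = x₀

pointOf-∈ : ∀ {n} {p : Subset n} (x₀ : Fin n) (d : Dec (Nonempty p)) →
  ¬ Empty p → pointOf x₀ d ∈ p
pointOf-∈ _ (yes (_ , x∈p)) _        = x∈p
pointOf-∈ _ (no empty)      nonempty = ⊥-elim (nonempty empty)

module Heads {n r : ℕ} (G : KneserSubgraph n r) where
  open KneserSubgraph G

  IsHead : Subset n → Fin n → Set
  IsHead S h = h ∉ S × (∀ T → adj S T ≡ true → h ∈ T)

  embedding : (head : Subset n → Fin n) → (∀ S → inV S ≡ true → IsHead S (head S)) →
    HasSubgraphIsoTo n r G
  embedding head isHead = φ , vertex , injective , edge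
    where
    φ : Subset n → Fin n × Subset n
    φ S = head S , S
    vertex : ∀ S → inV S ≡ true → HVertex n r (φ S)
    vertex S S∈V = V-vertex S S∈V , proj₁ (isHead S S∈V)
    injective : ∀ S S′ → inV S ≡ true → inV S′ ≡ true → φ S ≡ φ S′ → S ≡ S′
    injective _ _ _ _ = cong proj₂
    edge : ∀ S S′ → adj S S′ ≡ true → HAdj (φ S) (φ S′)
    edge S S′ e =
      proj₂ (isHead S (proj₁ (adj-V S S′ e))) S′ e ,
      proj₂ (isHead S′ (proj₂ (adj-V S S′ e))) S (trans (adj-sym S′ S) e) ,
      adj-K S S′ e

  neighbours : Subset n → List (Subset n)
  neighbours S = filter (λ T → adj S T ≟ true) (allSubsets n)

  ∈-neighbours : ∀ {S T} → adj S T ≡ true → T ∈ₗ neighbours S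
  ∈-neighbours {S} {T} e = ∈-filter⁺ (λ U → adj S U ≟ true) (∈-allSubsets n T) e

  neighbour-adj : ∀ {S T} → T ∈ₗ neighbours S → adj S T ≡ true
  neighbour-adj {S} T∈ = proj₂ (∈-filter⁻ (λ U → adj S U ≟ true) {xs = allSubsets n} T∈)

  degree≡length-neighbours : ∀ S → degree G S ≡ length (neighbours S)
  degree≡length-neighbours S = sum-indicator≡length-filter (adj S) (allSubsets n)

  missed : Subset n → Subset n
  missed S = ⋃ (map (λ T → ∁ S ∩ ∁ T) (neighbours S))

  heads : Subset n → Subset n
  heads S = ∁ S ∩ ∁ (missed S)

  heads-are-heads : ∀ {S h} → h ∈ heads S → IsHead S h
  heads-are-heads {S} {h} h∈heads = x∈∁p⇒x∉p h∈∁S , h∈neighbour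
    where
    h∈∁S : h ∈ ∁ S
    h∈∁S = proj₁ (x∈p∩q⁻ (∁ S) (∁ (missed S)) h∈heads)
    h∉missed : h ∉ missed S
    h∉missed = x∈∁p⇒x∉p (proj₂ (x∈p∩q⁻ (∁ S) (∁ (missed S)) h∈heads))
    h∈neighbour : ∀ T → adj S T ≡ true → h ∈ T
    h∈neighbour T e = x∉∁p⇒x∈p λ h∈∁T →
      h∉missed (∈⋃⁺ (∈-map⁺ (λ U → ∁ S ∩ ∁ U) (∈-neighbours e)) (x∈p∩q⁺ (h∈∁S , h∈∁T)))

  ∁⊆missed : ∀ S → Empty (heads S) → ∁ S ⊆ missed S
  ∁⊆missed S noHeads {h} h∈∁S with h ∈? missed S
  ... | yes h∈missed = h∈missed
  ... | no  h∉missed = ⊥-elim (noHeads (h , x∈p∩q⁺ (h∈∁S , x∉p⇒x∈∁p h∉missed)))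

  ∣missed-by-neighbour∣ : ∀ S T → adj S T ≡ true → ∣ ∁ S ∩ ∁ T ∣ ≡ n ∸ 2 * r
  ∣missed-by-neighbour∣ S T e = begin
    ∣ ∁ S ∩ ∁ T ∣        ≡⟨ ∣∁p∩∁q∣ S T (adj-K S T e) ⟩
    n ∸ (∣ S ∣ + ∣ T ∣)  ≡⟨ cong₂ (λ a b → n ∸ (a + b)) (V-vertex S S∈V) (V-vertex T T∈V) ⟩
    n ∸ (r + r)          ≡⟨ cong (λ k → n ∸ (r + k)) (+-identityʳ r) ⟨
    n ∸ 2 * r            ∎
    where
    open ≡-Reasoning
    S∈V : inV S ≡ true
    S∈V = proj₁ (adj-V S T e)
    T∈V : inV T ≡ true
    T∈V = proj₂ (adj-V S T e)

  ∣missed∣≤ : ∀ S → ∣ missed S ∣ ≤ degree G S * (n ∸ 2 * r)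
  ∣missed∣≤ S = begin
    ∣ missed S ∣                                   ≤⟨ ∣⋃∣≤sum missedBy (neighbours S) ⟩
    sum (map (λ T → ∣ missedBy T ∣) (neighbours S)) ≡⟨ sum-constant (λ T → ∣ missedBy T ∣) (n ∸ 2 * r)
                                                         (neighbours S) ∣missedBy∣ ⟩
    length (neighbours S) * (n ∸ 2 * r)            ≡⟨ cong (_* (n ∸ 2 * r)) (degree≡length-neighbours S) ⟨
    degree G S * (n ∸ 2 * r)                       ∎
    where
    open ≤-Reasoning
    missedBy : Subset n → Subset n
    missedBy T = ∁ S ∩ ∁ T
    ∣missedBy∣ : ∀ T → T ∈ₗ neighbours S → ∣ missedBy T ∣ ≡ n ∸ 2 * r
    ∣missedBy∣ T T∈ = ∣missed-by-neighbour∣ S T (neighbour-adj T∈)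

  heads-nonempty : ∀ S → inV S ≡ true → degree G S * (n ∸ 2 * r) < n ∸ r → ¬ Empty (heads S)
  heads-nonempty S S∈V small noHeads = <-irrefl refl (≤-<-trans n∸r≤ small)
    where
    open ≤-Reasoning
    n∸r≤ : n ∸ r ≤ degree G S * (n ∸ 2 * r)
    n∸r≤ = begin
      n ∸ r                    ≡⟨ cong (n ∸_) (V-vertex S S∈V) ⟨
      n ∸ ∣ S ∣                ≡⟨ ∣∁p∣≡n∸∣p∣ S ⟨
      ∣ ∁ S ∣                  ≤⟨ p⊆q⇒∣p∣≤∣q∣ (∁⊆missed S noHeads) ⟩
      ∣ missed S ∣             ≤⟨ ∣missed∣≤ S ⟩
      degree G S * (n ∸ 2 * r) ∎

-- Theorem 8: if n ≥ 2r + 1 and every vertex of G ⊆ K_{n:r} has degree below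
-- (n - r)/(n - 2r), then H_{n:r} contains a copy of G.

mainTheorem8 : (n r : ℕ) → 1 ≤ r → 2 * r + 1 ≤ n →
    (G : KneserSubgraph n r) →
    (∀ S → KneserSubgraph.inV G S ≡ true → degree G S * (n ∸ 2 * r) < n ∸ r) →
    HasSubgraphIsoTo n r G
mainTheorem8 n r _ 2r+1≤n G smallDegree = embedding head isHead
  where
  open Heads G
  -- n ≥ 1, so Fin n has a point to fall back on outside V(G).
  h₀ : Fin n
  h₀ = fromℕ< (≤-trans (m≤n+m 1 (2 * r)) 2r+1≤n)
  head : Subset n → Fin n
  head S = pointOf h₀ (nonempty? (heads S))
  isHead : ∀ S → KneserSubgraph.inV G S ≡ true → IsHead S (head S)
  isHead S S∈V =
    heads-are-heads (pointOf-∈ h₀ (nonempty? (heads S)) (heads-nonempty S S∈V (smallDegree S S∈V)))
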